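{- Let $\mathfrak{C}$ be a class of dynamic operators $\star$ satisfying (Faith) and $\mathfrak{M}\subseteq \mathit{Mod}(\mathcal{L}_\leq)$ be a class of preference models. The following axiom schema is valid in $\langle \mathfrak{M}, \mathfrak{C}\rangle$, for any propositional formula $\varphi \in \mathcal{L}_0$: $$ E\varphi \rightarrow (\mu\varphi \leftrightarrow [\star\varphi]\mu\top)$$
   Context: Fix a set $P$ of propositional letters; $\mathcal{L}_0$ is the classical propositional language over $P$. A (well-founded) preference model is $M=\langle W,\leq,v\rangle$ with $W$ a set of worlds, $\leq$ a reflexive, transitive relation on $W$ whose strict part $<$ is well-founded, and $v:P\to 2^W$ a valuation; $\mathit{Mod}(\mathcal{L}_\leq)$ is the class of all such models. A dynamic operator is a map $\star:\mathit{Mod}(\mathcal{L}_\leq)\times\mathcal{L}_0\to\mathit{Mod}(\mathcal{L}_\leq)$ with $\star(M,\varphi)=\langle W,\leq_{\star\varphi},v\rangle$ (same worlds and valuation). The language $\mathcal{L}_\leq(\star)$ is built from $P$ with $\neg,\wedge$, the universal modality $A$ (with dual $E\varphi=\neg A\neg\varphi$), the modalities $[\leq]$, $[<]$ (dual $\langle<\rangle$), and formulas $[\star\varphi]\xi$ with $\varphi\in\mathcal{L}_0$. A dynamic model is $D=\langle M,\star\rangle$, with standard clauses for $A,[\leq],[<]$ and $D,w\vDash[\star\varphi]\xi$ iff $\langle\star(M,\varphi),\star\rangle,w\vDash\xi$. For a class $\mathfrak{M}$ of preference models and a class $\mathfrak{C}$ of dynamic operators closed over $\mathfrak{M}$, $\langle\mathfrak{M},\mathfrak{C}\rangle$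 is the class of dynamic models $\langle M,\star\rangle$ with $M\in\mathfrak{M}$, $\star\in\mathfrak{C}$; a formula is valid in it if true at every world of every such model. $[\![\varphi]\!]$ denotes the set of worlds of the model satisfying $\varphi$; $Min_\leq X=\{w\in X\mid$ there is no $w'\in X$ with $w'<w\}$. $\mu\varphi:=\varphi\wedge\neg\langle<\rangle\varphi$, which holds at $w$ iff $w\in Min_\leq[\![\varphi]\!]$. $\star$ satisfies (Faith) if whenever $[\![\varphi]\!]\neq\emptyset$, $Min_\leq[\![\varphi]\!]=Min_{\leq_{\star\varphi}}W$. -}

module Defs where

open import Level using (Level; _⊔_) renaming (suc to lsuc; zero to lzero)
open import Data.Product using (Σ; _×_; _,_)
open import Relation.Nullary using (¬_)
open import Relation.Binary.Core using (Rel)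
open import Relation.Binary.Definitions using (Reflexive; Transitive)
open import Induction.WellFounded using (WellFounded)

data Form0 (P : Set) : Set where
  atom0 : P → Form0 P
  neg0  : Form0 P → Form0 P
  and0  : Form0 P → Form0 P → Form0 P

-- The language L_≤(⋆): letters, ⊤, ¬, ∧, A, [≤], [<], [⋆φ]ξ (φ ∈ L₀)
data Form (P : Set) : Set where
  atom  : P → Form P
  top   : Form P
  neg   : Form P → Form P
  and   : Form P → Form P → Form P
  Aᵤ    : Form P → Form P
  box≤  : Form P → Form P
  box<  : Form P → Form P
  dyn   : Form0 P → Form P → Form P

emb : {P : Set} → Form0 P → Form P
emb (atom0 p)  = atom p
emb (neg0 φ)   = neg (emb φ)
emb (and0 φ ψ) = and (emb φ) (emb ψ)

_⇒_ : {P : Set} → Form P → Form P → Form P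
φ ⇒ ψ = neg (and φ (neg ψ))

_⇔_ : {P : Set} → Form P → Form P → Form P
φ ⇔ ψ = and (φ ⇒ ψ) (ψ ⇒ φ)

Eₑ : {P : Set} → Form P → Form P
Eₑ φ = neg (Aᵤ (neg φ))

dia< : {P : Set} → Form P → Form P
dia< φ = neg (box< (neg φ))

μ : {P : Set} → Form P → Form P
μ φ = and φ (neg (dia< φ))

Strict : {W : Set} → Rel W lzero → Rel W lzero
Strict _≤_ x y = x ≤ y × ¬ (y ≤ x)

record PrefOrder (W : Set) : Set₁ where
  field
    _≤_   : Rel W lzero
    refl≤ : Reflexive _≤_
    trans≤ : Transitive _≤_
    wf<   : WellFounded (Strict _≤_)

record Model (P : Set) : Set₁ where
  field
    W   : Set
    ord : PrefOrder W
    v   : P → W → Set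
  open PrefOrder ord public

open Model public

-- a dynamic operator: keeps worlds and valuation, changes the order
Op : Set → Set₁
Op P = (M : Model P) → Form0 P → PrefOrder (W M)

apply : {P : Set} → Op P → Model P → Form0 P → Model P
apply ⋆ M φ = record { W = W M ; ord = ⋆ M φ ; v = v M }

sat : {P : Set} (M : Model P) → Op P → W M → Form P → Set
sat M ⋆ w (atom p)   = v M p w
sat M ⋆ w top        = Level.Lift lzero (Data.Unit.⊤)
  where import Data.Unit
sat M ⋆ w (neg ξ)    = ¬ sat M ⋆ w ξ
sat M ⋆ w (and ξ χ)  = sat M ⋆ w ξ × sat M ⋆ w χ
sat M ⋆ w (Aᵤ ξ)     = (w' : W M) → sat M ⋆ w' ξ
sat M ⋆ w (box≤ ξ)   = (w' : W M) → _≤_ M w' w → sat M ⋆ w' ξ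
sat M ⋆ w (box< ξ)   = (w' : W M) → Strict (_≤_ M) w' w → sat M ⋆ w' ξ
sat M ⋆ w (dyn φ ξ)  = sat (apply ⋆ M φ) ⋆ w ξ

⟦_⟧ : {P : Set} → Form P → (M : Model P) → Op P → W M → Set
⟦ φ ⟧ M ⋆ w = sat M ⋆ w φ

Min : {W : Set} → Rel W lzero → (W → Set) → W → Set
Min _≤_ X w = X w × ¬ (Σ _ λ w' → X w' × Strict _≤_ w' w)

Faith : {P : Set} → Op P → Set₁
Faith {P} ⋆ = (M : Model P) (φ : Form0 P) →
  ¬ ((w : W M) → ¬ ⟦ emb φ ⟧ M ⋆ w) →
  (w : W M) →
    (Min (_≤_ M) (⟦ emb φ ⟧ M ⋆) w → Min (PrefOrder._≤_ (⋆ M φ)) (λ _ → Data.Unit.⊤) w)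
  × (Min (PrefOrder._≤_ (⋆ M φ)) (λ _ → Data.Unit.⊤) w → Min (_≤_ M) (⟦ emb φ ⟧ M ⋆) w)
  where import Data.Unit

ClosedOver : {P : Set} {ℓ₁ ℓ₂ : Level} → (Model P → Set ℓ₁) → (Op P → Set ℓ₂) → Set (lsuc lzero ⊔ ℓ₁ ⊔ ℓ₂)
ClosedOver {P} 𝔐 ℭ = (⋆ : Op P) → ℭ ⋆ → (M : Model P) → 𝔐 M → (φ : Form0 P) → 𝔐 (apply ⋆ M φ)

Valid : {P : Set} {ℓ₁ ℓ₂ : Level} → (Model P → Set ℓ₁) → (Op P → Set ℓ₂) → Form P → Set (lsuc lzero ⊔ ℓ₁ ⊔ ℓ₂)
Valid {P} 𝔐 ℭ ξ = (M : Model P) → 𝔐 M → (⋆ : Op P) → ℭ ⋆ → (w : W M) → sat M ⋆ w ξ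

module Submission where

open import Level using (Level; lift)
open import Data.Product using (_,_; proj₁; proj₂)
open import Data.Unit using (⊤; tt)
open import Function using (_∘_)
open import Relation.Binary.Core using (Rel)
open import Defs

-- Under (Faith), μφ is literally membership in Min_≤ ⟦φ⟧ and [⋆φ]μ⊤ is
-- membership in Min_{≤⋆φ} W; the two sets coincide once ⟦φ⟧ is nonempty.
-- The argument is intuitionistic because Eφ and the premise of (Faith)
-- are the same double negation.

module _ {P : Set} (M : Model P) (⋆ : Op P) where

  sat-⇒ : (ξ χ : Form P) {w : W M} →
          (sat M ⋆ w ξ → sat M ⋆ w χ) → sat M ⋆ w (ξ ⇒ χ)
  sat-⇒ _ _ f (x , ¬y) = ¬y (f x)

  sat-⇔ : (ξ χ : Form P) {w : W M} →
          (sat M ⋆ w ξ → sat M ⋆ w χ) → (sat M ⋆ w χ → sat M ⋆ w ξ) →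
          sat M ⋆ w (ξ ⇔ χ)
  sat-⇔ ξ χ f g = sat-⇒ ξ χ f , sat-⇒ χ ξ g

  sat-μ⇒Min : (ξ : Form P) {w : W M} →
              sat M ⋆ w (μ ξ) → Min (_≤_ M) (⟦ ξ ⟧ M ⋆) w
  sat-μ⇒Min _ (x , ¬¬noneBelow) =
    x , λ (w' , x' , w'<w) → ¬¬noneBelow λ noneBelow → noneBelow w' w'<w x'

  Min⇒sat-μ : (ξ : Form P) {w : W M} →
              Min (_≤_ M) (⟦ ξ ⟧ M ⋆) w → sat M ⋆ w (μ ξ)
  Min⇒sat-μ _ (x , noneBelow) =
    x , λ ¬noneBelow → ¬noneBelow λ w' w'<w x' → noneBelow (w' , x' , w'<w)

Min-cong : {A : Set} (_≤_ : Rel A _) {X Y : A → Set} →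
           (∀ {a} → X a → Y a) → (∀ {a} → Y a → X a) →
           ∀ {a} → Min _≤_ X a → Min _≤_ Y a
Min-cong _ X⊆Y Y⊆X (x , noneBelow) = X⊆Y x , λ (b , y , b<a) → noneBelow (b , Y⊆X y , b<a)

module _ {P : Set} (M : Model P) (⋆ : Op P) (φ : Form0 P) {w : W M} where

  sat-dyn-μ⊤⇒Min : sat M ⋆ w (dyn φ (μ top)) → Min (PrefOrder._≤_ (⋆ M φ)) (λ _ → ⊤) w
  sat-dyn-μ⊤⇒Min = Min-cong (PrefOrder._≤_ (⋆ M φ)) (λ _ → tt) (λ _ → lift tt) ∘ sat-μ⇒Min (apply ⋆ M φ) ⋆ top

  Min⇒sat-dyn-μ⊤ : Min (PrefOrder._≤_ (⋆ M φ)) (λ _ → ⊤) w → sat M ⋆ w (dyn φ (μ top))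
  Min⇒sat-dyn-μ⊤ = Min⇒sat-μ (apply ⋆ M φ) ⋆ top ∘ Min-cong (PrefOrder._≤_ (⋆ M φ)) (λ _ → lift tt) (λ _ → tt)

proposition20 : {P : Set} {ℓ₁ ℓ₂ : Level} (𝔐 : Model P → Set ℓ₁) (ℭ : Op P → Set ℓ₂) →
    ((⋆ : Op P) → ℭ ⋆ → Faith ⋆) →
    ClosedOver 𝔐 ℭ →
    (φ : Form0 P) →
    Valid 𝔐 ℭ (Eₑ (emb φ) ⇒ (μ (emb φ) ⇔ dyn φ (μ top)))
proposition20 𝔐 ℭ faith _ φ M _ ⋆ ⋆∈ℭ w =
  sat-⇒ M ⋆ (Eₑ (emb φ)) (μ (emb φ) ⇔ dyn φ (μ top)) λ ⟦φ⟧≠∅ →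
    let minφ⇔min⋆ = faith ⋆ ⋆∈ℭ M φ ⟦φ⟧≠∅ w
    in sat-⇔ M ⋆ (μ (emb φ)) (dyn φ (μ top))
         (Min⇒sat-dyn-μ⊤ M ⋆ φ ∘ proj₁ minφ⇔min⋆ ∘ sat-μ⇒Min M ⋆ (emb φ))
         (Min⇒sat-μ M ⋆ (emb φ) ∘ proj₂ minφ⇔min⋆ ∘ sat-dyn-μ⊤⇒Min M ⋆ φ)
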